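{- Let $n\ge 2$ and let $Q_{4n}=\langle a,b : a^{2n}=e,\ a^n=b^2,\ ba=a^{ -1}b\rangle$ be the generalized quaternion group. Then $CSEP(Q_{4n})\cong H[\Gamma_1,\dots,\Gamma_{n+3}]$, where $\Gamma_1=\Gamma_2=K_1$, $\Gamma_i=K_2$ for $3\le i\le n+1$, $\Gamma_{n+2}=\Gamma_{n+3}=K_n$, and (i) if $n$ is odd, $H=K_2\vee(K_{n-1}\cup K_2)$, with vertices $1,2$ the first $K_2$, vertices $3,\dots,n+1$ the vertices of $K_{n-1}$, and vertices $n+2,n+3$ the second $K_2$; (ii) if $n$ is even, $H=K_2\vee(K_{n-1}\cup K_1\cup K_1)$, with vertices $1,2$ the $K_2$, vertices $3,\dots,n+1$ the vertices of $K_{n-1}$, and vertices $n+2,n+3$ the two $K_1$'s.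
   Context: For a finite group $G$ and $x\in G$, $[x]$ denotes the conjugacy class of $x$. The conjugacy superenhanced power graph $CSEP(G)$ is the simple graph with vertex set $G$ in which two distinct vertices $x,y$ are adjacent iff there exist $x'\in[x]$, $y'\in[y]$ lying in a common cyclic subgroup of $G$ ($x'=y'$ permitted, so distinct conjugate elements are always adjacent). $K_m$ is the complete graph on $m$ vertices; $\cup$ is disjoint union and $\vee$ is join (disjoint union plus all edges between the two parts). For a graph $H$ on $\{1,\dots,k\}$ and graphs $\Gamma_1,\dots,\Gamma_k$, the generalized composition $H[\Gamma_1,\dots,\Gamma_k]$ has vertex set the disjoint union of the $V(\Gamma_i)$, with $u\in V(\Gamma_i)$, $v\in V(\Gamma_j)$ adjacent iff either $i=j$ and $u\sim v$ in $\Gamma_i$, or $i\neq j$ and $i\sim j$ in $H$. -}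

module Defs where

open import Level using (0ℓ)
open import Data.Nat using (ℕ; zero; suc; _+_; _*_; _∸_; NonZero)
open import Data.Nat.Properties using (m*n≢0)
open import Data.Nat.DivMod using (_mod_)
open import Data.Fin using (Fin; toℕ)
open import Data.Bool using (Bool; true; false)
open import Data.Product using (Σ; ∃; _×_; _,_)
open import Data.Sum using (_⊎_; inj₁; inj₂)
open import Relation.Nullary using (¬_)
open import Relation.Binary.PropositionalEquality using (_≡_)
open import Algebra.Bundles.Raw using (RawGroup)
open import Function.Bundles using (_↔_; _⇔_; Inverse)

record Graph : Set₁ where
  field
    V   : Set
    Adj : V → V → Set
open Graph public

record _≅_ (G H : Graph) : Set where
  field
    bij : V G ↔ V H
    adj : ∀ x y → Adj G x y ⇔ Adj H (Inverse.to bij x) (Inverse.to bij y)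

K : ℕ → Graph
K m = record { V = Fin m ; Adj = λ u v → ¬ (u ≡ v) }

_∪G_ : Graph → Graph → Graph
G ∪G H = record { V = V G ⊎ V H ; Adj = adj }
  where
  adj : V G ⊎ V H → V G ⊎ V H → Set
  adj (inj₁ u) (inj₁ v) = Adj G u v
  adj (inj₂ u) (inj₂ v) = Adj H u v
  adj _ _ = Data.Empty.⊥
    where import Data.Empty

_∨G_ : Graph → Graph → Graph
G ∨G H = record { V = V G ⊎ V H ; Adj = adj }
  where
  open import Data.Unit using (⊤)
  adj : V G ⊎ V H → V G ⊎ V H → Set
  adj (inj₁ u) (inj₁ v) = Adj G u v
  adj (inj₂ u) (inj₂ v) = Adj H u v
  adj (inj₁ _) (inj₂ _) = ⊤
  adj (inj₂ _) (inj₁ _) = ⊤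

GenComp : (H : Graph) → (V H → Graph) → Graph
GenComp H Γ = record
  { V   = Σ (V H) (λ i → V (Γ i))
  ; Adj = λ { (i , u) (j , v) →
              (Σ (i ≡ j) (λ { _≡_.refl → Adj (Γ i) u v }))
              ⊎ (¬ (i ≡ j) × Adj H i j) }
  }

module _ (G : RawGroup 0ℓ 0ℓ) where
  open RawGroup G

  pow : Carrier → ℕ → Carrier
  pow z zero    = ε
  pow z (suc k) = z ∙ pow z k

  Conj : Carrier → Carrier → Set
  Conj x x' = ∃ λ g → x' ≈ ((g ∙ x) ∙ (g ⁻¹))

  -- w lies in the cyclic subgroup ⟨z⟩ (G finite, so ⟨z⟩ = {z^k | k ∈ ℕ})
  InCyclic : Carrier → Carrier → Set
  InCyclic z w = ∃ λ k → w ≈ pow z k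

  CSEP : Graph
  CSEP = record
    { V   = Carrier
    ; Adj = λ x y → ¬ (x ≈ y) ×
              (∃ λ x' → ∃ λ y' → ∃ λ z →
                 Conj x x' × Conj y y' × InCyclic z x' × InCyclic z y')
    }

-- Generalized quaternion group Q_{4n}: the element (i , false) is a^i,
-- the element (i , true) is a^i b, with i taken modulo 2n.
-- Relations: a^{2n} = e, b^2 = a^n, b a = a^{-1} b, hence
--   a^i · a^k     = a^{i+k}
--   a^i · a^k b   = a^{i+k} b
--   a^i b · a^k   = a^{i-k} b
--   a^i b · a^k b = a^{i-k+n}
--   (a^i)⁻¹ = a^{-i},  (a^i b)⁻¹ = a^{i+n} b.

module _ (n : ℕ) .{{_ : NonZero n}} where
  private
    instance
      nz : NonZero (2 * n)
      nz = m*n≢0 2 n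

    M : ℕ
    M = 2 * n

    md : ℕ → Fin M
    md x = x mod M

    QC : Set
    QC = Fin M × Bool

    mul : QC → QC → QC
    mul (i , false) (k , false) = md (toℕ i + toℕ k) , false
    mul (i , false) (k , true)  = md (toℕ i + toℕ k) , true
    mul (i , true)  (k , false) = md (toℕ i + (M ∸ toℕ k)) , true
    mul (i , true)  (k , true)  = md (toℕ i + (M ∸ toℕ k) + n) , false

    inv : QC → QC
    inv (i , false) = md (M ∸ toℕ i) , false
    inv (i , true)  = md (toℕ i + n) , true

  Quaternion : RawGroup 0ℓ 0ℓ
  Quaternion = record
    { Carrier = QC
    ; _≈_     = _≡_
    ; _∙_     = mul
    ; ε       = md 0 , false
    ; _⁻¹     = inv
    }

-- The graphs H and the family Γ of the theorem.
-- Vertex labelling: inj₁ _ ↦ vertices 1,2 ; inj₂ (inj₁ _) ↦ vertices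
-- 3..n+1 ; inj₂ (inj₂ _) ↦ vertices n+2, n+3.

Hodd : ℕ → Graph
Hodd n = K 2 ∨G (K (n ∸ 1) ∪G K 2)

Heven : ℕ → Graph
Heven n = K 2 ∨G (K (n ∸ 1) ∪G (K 1 ∪G K 1))

Γodd : (n : ℕ) → V (Hodd n) → Graph
Γodd n (inj₁ _)        = K 1
Γodd n (inj₂ (inj₁ _)) = K 2
Γodd n (inj₂ (inj₂ _)) = K n

Γeven : (n : ℕ) → V (Heven n) → Graph
Γeven n (inj₁ _)        = K 1
Γeven n (inj₂ (inj₁ _)) = K 2
Γeven n (inj₂ (inj₂ _)) = K n

{-# OPTIONS --safe #-}
module Submission where

-- Call two kinds of elements of Q₄ₙ linked when some maximal cyclic subgroup
-- contains elements of both. The maximal cyclic subgroups are ⟨a⟩ and the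
-- ⟨aⁱb⟩ = {e, aⁱb, aⁿ, aⁱ⁺ⁿb}, and conjugation only sends aⁱ to a⁻ⁱ and aⁱb to
-- the aʲb with j ≡ i (mod 2). So two distinct elements are adjacent in
-- CSEP(Q₄ₙ) exactly when their kinds (e, aⁿ, another power of a, or aⁱb with
-- i of a given parity) are linked. The same holds in H[Γ] once each vertex is
-- labelled by the kind its H-vertex stands for. Both graphs have equally many
-- vertices of each kind, so any bijection that preserves kinds is an
-- isomorphism. The parity of n matters only through aⁱ⁺ⁿb, which has the same
-- parity as aⁱb exactly when n is even.

open import Defs
open import Level using (0ℓ)
open import Algebra.Bundles.Raw using (RawGroup)
open import Data.Bool using (true; false)
open import Data.Empty using (⊥-elim)
open import Data.Fin as Fin
  using (Fin; zero; suc; toℕ; cast; combine; remQuot; splitAt; _↑ˡ_; _↑ʳ_)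
open import Data.Fin.Patterns using (0F; 1F)
open import Data.Fin.Properties
  using ( toℕ-injective; toℕ-fromℕ<; toℕ<n; toℕ-↑ˡ; toℕ-↑ʳ; toℕ-cast; toℕ-combine
        ; cast-involutive; combine-remQuot; remQuot-combine
        ; splitAt-↑ˡ; splitAt-↑ʳ; splitAt⁻¹-↑ˡ; splitAt⁻¹-↑ʳ )
open import Data.Nat
  using (ℕ; zero; suc; z<s; >-nonZero⁻¹; _+_; _*_; _∸_; _≤_; _<_; _%_; NonZero; _≟_)
open import Data.Nat.DivMod
  using ( _mod_; _/_; m%n%n≡m%n; n%n≡0; m%n<n; m%n≤n; m<n⇒m%n≡m
        ; %-distribˡ-+; %-distribˡ-*; %-remove-+ʳ; m∣n⇒o%n%m≡o%m; m*[n/m]≡n )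
open import Data.Nat.Divisibility using (m∣m*n; m%n≡0⇒n∣m)
open import Data.Nat.Properties
  using ( m<m+n; <⇒≤; <⇒≢; suc-injective; +-identityʳ; +-assoc; +-comm
        ; m+[n∸m]≡n; m∸n+n≡m; m+n∸m≡n; m+1+n≢m; *-comm; +-commutativeSemigroup )
open import Algebra.Properties.CommutativeSemigroup +-commutativeSemigroup
  using (xy∙z≈y∙zx; xy∙z≈xz∙y; xy∙z≈y∙xz)
open import Data.Nat.Tactic.RingSolver using (solve-∀)
open import Data.Product using (∃; _×_; _,_; proj₁; proj₂)
open import Data.Sum using (inj₁; inj₂; [_,_])
open import Data.Sum.Properties using (≡-dec)
open import Data.Unit using (tt)
open import Function using (_∘_)
open import Function.Bundles using (_↔_; _⇔_; mk⇔; mk↔ₛ′; Inverse; Equivalence)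
import Function.Properties.Equivalence as ⇔
open import Function.Properties.Inverse using (↔-trans)
open import Relation.Binary using (Setoid; Symmetric; DecidableEquality)
open import Relation.Binary.PropositionalEquality
  using (_≡_; _≢_; refl; sym; trans; cong; cong₂; subst; subst₂)
import Relation.Binary.Reasoning.Setoid as SetoidReasoning
open import Relation.Nullary using (¬_; yes; no; contradiction)

-- Graphs whose adjacency is read off vertex labels

module _ {L : Set} (R : L → L → Set) where

  AdjacencyBy : (G : Graph) → (V G → L) → Set
  AdjacencyBy G ℓ = ∀ x y → Adj G x y ⇔ (x ≢ y × R (ℓ x) (ℓ y))

  DistinctAdjacencyBy : (G : Graph) → (V G → L) → Set
  DistinctAdjacencyBy G ℓ = ∀ x y → x ≢ y → Adj G x y ⇔ R (ℓ x) (ℓ y)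

  ≅-byLabels : ∀ {G H ℓ ℓ′} → AdjacencyBy G ℓ → AdjacencyBy H ℓ′ →
               (e : V G ↔ V H) → (∀ y → ℓ (Inverse.from e y) ≡ ℓ′ y) → G ≅ H
  ≅-byLabels {ℓ = ℓ} {ℓ′} adjG adjH e ℓ-from = record
    { bij = e
    ; adj = λ x y → ⇔.trans (adjG x y) (⇔.trans (transport x y) (⇔.sym (adjH (to x) (to y))))
    }
    where
    open Inverse e
    to-injective : ∀ {x y} → to x ≡ to y → x ≡ y
    to-injective {x} {y} eq =
      trans (sym (strictlyInverseʳ x)) (trans (cong from eq) (strictlyInverseʳ y))
    ℓ-to : ∀ x → ℓ′ (to x) ≡ ℓ x
    ℓ-to x = trans (sym (ℓ-from (to x))) (cong ℓ (strictlyInverseʳ x))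
    transport : ∀ x y → (x ≢ y × R (ℓ x) (ℓ y)) ⇔ (to x ≢ to y × R (ℓ′ (to x)) (ℓ′ (to y)))
    transport x y = mk⇔
      (λ (x≢y , r) → (x≢y ∘ to-injective) , subst₂ R (sym (ℓ-to x)) (sym (ℓ-to y)) r)
      (λ (tx≢ty , r) → (λ eq → tx≢ty (cong to eq)) , subst₂ R (ℓ-to x) (ℓ-to y) r)

  K-distinctAdjacency : ∀ {m} {ℓ : Fin m → L} →
                        (∀ u v → R (ℓ u) (ℓ v)) → DistinctAdjacencyBy (K m) ℓ
  K-distinctAdjacency linked u v u≢v = mk⇔ (λ _ → linked u v) (λ _ → u≢v)

  module _ (R-sym : Symmetric R) {G H : Graph} {ℓ : V G → L} {ℓ′ : V H → L}
           (adjG : DistinctAdjacencyBy G ℓ) (adjH : DistinctAdjacencyBy H ℓ′) where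

    ∪G-distinctAdjacency : (∀ u v → ¬ R (ℓ u) (ℓ′ v)) → DistinctAdjacencyBy (G ∪G H) [ ℓ , ℓ′ ]
    ∪G-distinctAdjacency unlinked (inj₁ u) (inj₁ v) ne = adjG u v (ne ∘ cong inj₁)
    ∪G-distinctAdjacency unlinked (inj₂ u) (inj₂ v) ne = adjH u v (ne ∘ cong inj₂)
    ∪G-distinctAdjacency unlinked (inj₁ u) (inj₂ v) _  = mk⇔ (λ ()) (unlinked u v)
    ∪G-distinctAdjacency unlinked (inj₂ u) (inj₁ v) _  = mk⇔ (λ ()) (unlinked v u ∘ R-sym)

    ∨G-distinctAdjacency : (∀ u v → R (ℓ u) (ℓ′ v)) → DistinctAdjacencyBy (G ∨G H) [ ℓ , ℓ′ ]
    ∨G-distinctAdjacency linked (inj₁ u) (inj₁ v) ne = adjG u v (ne ∘ cong inj₁)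
    ∨G-distinctAdjacency linked (inj₂ u) (inj₂ v) ne = adjH u v (ne ∘ cong inj₂)
    ∨G-distinctAdjacency linked (inj₁ u) (inj₂ v) _  = mk⇔ (λ _ → linked u v) (λ _ → tt)
    ∨G-distinctAdjacency linked (inj₂ u) (inj₁ v) _  = mk⇔ (λ _ → R-sym (linked v u)) (λ _ → tt)

  module _ {H : Graph} {Γ : V H → Graph} {ℓ : V H → L}
           (_≟ᴴ_ : DecidableEquality (V H))
           (Γ-complete : ∀ i u v → Adj (Γ i) u v ⇔ u ≢ v)
           (R-refl : ∀ i → R (ℓ i) (ℓ i))
           (adjH : DistinctAdjacencyBy H ℓ) where

    private
      adj⇒ : ∀ i j u v → Adj (GenComp H Γ) (i , u) (j , v) → (i , u) ≢ (j , v) × R (ℓ i) (ℓ j)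
      adj⇒ i .i u v (inj₁ (refl , u~v)) =
        (λ { refl → Equivalence.to (Γ-complete i u v) u~v refl }) , R-refl i
      adj⇒ i j u v (inj₂ (i≢j , i~j))   = (i≢j ∘ cong proj₁) , Equivalence.to (adjH i j i≢j) i~j

      adj⇐ : ∀ i j u v → (i , u) ≢ (j , v) × R (ℓ i) (ℓ j) → Adj (GenComp H Γ) (i , u) (j , v)
      adj⇐ i j u v (ne , r) with i ≟ᴴ j
      ... | yes refl = inj₁ (refl , Equivalence.from (Γ-complete i u v) (ne ∘ cong (i ,_)))
      ... | no i≢j   = inj₂ (i≢j , Equivalence.from (adjH i j i≢j) r)

    GenComp-adjacency : AdjacencyBy (GenComp H Γ) (ℓ ∘ proj₁)
    GenComp-adjacency (i , u) (j , v) = mk⇔ (adj⇒ i j u v) (adj⇐ i j u v)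

-- Congruence modulo d

module Congruence (d : ℕ) .{{_ : NonZero d}} where

  -- A record rather than a % d ≡ b % d itself, which computes and so would
  -- leave a and b uninferable from the type.
  infix 4 _≈_
  record _≈_ (a b : ℕ) : Set where
    constructor mk≈
    field %-≡ : a % d ≡ b % d
  open _≈_ public

  ≈-setoid : Setoid 0ℓ 0ℓ
  ≈-setoid = record
    { _≈_           = _≈_
    ; isEquivalence = record
      { refl  = mk≈ refl
      ; sym   = λ p → mk≈ (sym (%-≡ p))
      ; trans = λ p q → mk≈ (trans (%-≡ p) (%-≡ q))
      }
    }

  open Setoid ≈-setoid public using () renaming (sym to ≈-sym; trans to ≈-trans)
  open SetoidReasoning ≈-setoid public

  %-≈ : ∀ a → a % d ≈ a
  %-≈ a = mk≈ (m%n%n≡m%n a d)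

  d≈0 : d ≈ 0
  d≈0 = mk≈ (trans (n%n≡0 d) (sym (m<n⇒m%n≡m (>-nonZero⁻¹ d))))

  toℕ-mod : ∀ a → toℕ (a mod d) ≈ a
  toℕ-mod a = mk≈ (trans (cong (_% d) (toℕ-fromℕ< _)) (%-≡ (%-≈ a)))

  mod-cong : ∀ {a b} → a ≈ b → a mod d ≡ b mod d
  mod-cong (mk≈ eq) = toℕ-injective (trans (toℕ-fromℕ< _) (trans eq (sym (toℕ-fromℕ< _))))

  mod-toℕ : ∀ {a} (i : Fin d) → a ≈ toℕ i → a mod d ≡ i
  mod-toℕ i (mk≈ eq) = toℕ-injective (trans (toℕ-fromℕ< _) (trans eq (m<n⇒m%n≡m (toℕ<n i))))

  mod-injective : ∀ {a b} → a mod d ≡ b mod d → a ≈ b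
  mod-injective eq = mk≈ (trans (sym (toℕ-fromℕ< _)) (trans (cong toℕ eq) (toℕ-fromℕ< _)))

  ≈⇒≡ : ∀ {a b} → a < d → b < d → a ≈ b → a ≡ b
  ≈⇒≡ a<d b<d (mk≈ eq) = trans (sym (m<n⇒m%n≡m a<d)) (trans eq (m<n⇒m%n≡m b<d))

  +-cong : ∀ {a b c e} → a ≈ b → c ≈ e → a + c ≈ b + e
  +-cong {a} {b} {c} {e} p q = begin
    a + c           ≈⟨ mk≈ (%-distribˡ-+ a c d) ⟩
    a % d + c % d   ≡⟨ cong₂ _+_ (%-≡ p) (%-≡ q) ⟩
    b % d + e % d   ≈⟨ mk≈ (%-distribˡ-+ b e d) ⟨
    b + e           ∎

  *-congˡ : ∀ a {b c} → b ≈ c → a * b ≈ a * c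
  *-congˡ a {b} {c} eq = begin
    a * b             ≈⟨ mk≈ (%-distribˡ-* a b d) ⟩
    a % d * (b % d)   ≡⟨ cong (a % d *_) (%-≡ eq) ⟩
    a % d * (c % d)   ≈⟨ mk≈ (%-distribˡ-* a c d) ⟨
    a * c             ∎

  +-congˡ : ∀ a {b c} → b ≈ c → a + b ≈ a + c
  +-congˡ a = +-cong (mk≈ refl)

  +-congʳ : ∀ {a b} c → a ≈ b → a + c ≈ b + c
  +-congʳ c p = +-cong p (mk≈ refl)

  ∸+≈0 : ∀ {t} → t ≤ d → (d ∸ t) + t ≈ 0
  ∸+≈0 {t} t≤d = begin
    (d ∸ t) + t   ≡⟨ m∸n+n≡m t≤d ⟩
    d             ≈⟨ d≈0 ⟩
    0             ∎

  +-cancelʳ : ∀ {a b} c → a + c ≈ b + c → a ≈ b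
  +-cancelʳ {a} {b} c eq = begin
    a                ≡⟨ +-identityʳ a ⟨
    a + 0            ≈⟨ +-congˡ a c+c′≈0 ⟨
    a + (c + c′)     ≡⟨ +-assoc a c c′ ⟨
    (a + c) + c′     ≈⟨ +-congʳ c′ eq ⟩
    (b + c) + c′     ≡⟨ +-assoc b c c′ ⟩
    b + (c + c′)     ≈⟨ +-congˡ b c+c′≈0 ⟩
    b + 0            ≡⟨ +-identityʳ b ⟩
    b                ∎
    where
    c′ : ℕ
    c′ = d ∸ c % d
    c+c′≈0 : c + c′ ≈ 0
    c+c′≈0 = begin
      c + c′         ≈⟨ +-congʳ c′ (%-≈ c) ⟨
      c % d + c′     ≡⟨ m+[n∸m]≡n (m%n≤n c d) ⟩
      d              ≈⟨ d≈0 ⟩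
      0              ∎

-- Computations in Q₄ₙ

-- n is written suc m so that Fin (2 * n) visibly has a successor structure,
-- which `encode` below pattern matches on.
module _ (m : ℕ) where

  private
    n M : ℕ
    n = suc m
    M = 2 * n

    Q : RawGroup 0ℓ 0ℓ
    Q = Quaternion n

  open RawGroup Q using (Carrier; _∙_; ε; _⁻¹)
  open Congruence M using (_≈_)
  open Congruence 2 using () renaming (_≈_ to _≈₂_)

  ⌊_⌋ : ℕ → Fin M
  ⌊ t ⌋ = t mod M

  parity : ℕ → Fin 2
  parity t = t mod 2

  a : Carrier
  a = ⌊ 1 ⌋ , false

  n<M : n < M
  n<M = m<m+n n z<s

  toℕ⌊⌋-< : ∀ {t} → t < M → toℕ ⌊ t ⌋ ≡ t
  toℕ⌊⌋-< t<M = trans (toℕ-fromℕ< _) (m<n⇒m%n≡m t<M)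

  toℕ⌊⌋≈₂ : ∀ t → toℕ ⌊ t ⌋ ≈₂ t
  toℕ⌊⌋≈₂ t = Congruence.mk≈
    (trans (cong (_% 2) (toℕ-fromℕ< (m%n<n t M))) (m∣n⇒o%n%m≡o%m 2 M t (m∣m*n n)))

  M∸⌊M∸t⌋≈t : ∀ {t} → t ≤ M → M ∸ toℕ ⌊ M ∸ t ⌋ ≈ t
  M∸⌊M∸t⌋≈t {t} t≤M = +-cancelʳ (M ∸ t) (begin
    (M ∸ c) + (M ∸ t) ≈⟨ +-congˡ (M ∸ c) (toℕ-mod (M ∸ t)) ⟨
    (M ∸ c) + c       ≈⟨ ∸+≈0 (<⇒≤ (toℕ<n ⌊ M ∸ t ⌋)) ⟩
    0                 ≈⟨ d≈0 ⟨
    M                 ≡⟨ m+[n∸m]≡n t≤M ⟨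
    t + (M ∸ t)       ∎)
    where
    open Congruence M
    c : ℕ
    c = toℕ ⌊ M ∸ t ⌋

  parity-cong : ∀ {s t} → s ≈₂ t → parity s ≡ parity t
  parity-cong = Congruence.mod-cong 2

  2*≈₂0 : ∀ t → 2 * t ≈₂ 0
  2*≈₂0 t = Congruence.mk≈ (%-remove-+ʳ 0 (m∣m*n t))

  +2*≈₂ : ∀ s t → s + 2 * t ≈₂ s
  +2*≈₂ s t = Congruence.mk≈ (%-remove-+ʳ s (m∣m*n t))

  M∸≈₂ : ∀ {t} → t ≤ M → M ∸ t ≈₂ t
  M∸≈₂ {t} t≤M = +-cancelʳ t (begin
    (M ∸ t) + t   ≡⟨ m∸n+n≡m t≤M ⟩
    2 * n         ≈⟨ 2*≈₂0 n ⟩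
    0             ≈⟨ 2*≈₂0 t ⟨
    2 * t         ≡⟨ cong (t +_) (+-identityʳ t) ⟩
    t + t         ∎)
    where open Congruence 2

  conjugate-rotation-by-rotation : ∀ k i →
    ((k , false) ∙ (i , false)) ∙ (k , false) ⁻¹ ≡ (i , false)
  conjugate-rotation-by-rotation k i = cong (_, false) (mod-toℕ i (begin
    toℕ ⌊ toℕ k + toℕ i ⌋ + toℕ ⌊ M ∸ toℕ k ⌋
      ≈⟨ +-cong (toℕ-mod (toℕ k + toℕ i)) (toℕ-mod (M ∸ toℕ k)) ⟩
    (toℕ k + toℕ i) + (M ∸ toℕ k)              ≡⟨ xy∙z≈y∙zx (toℕ k) (toℕ i) (M ∸ toℕ k) ⟩
    toℕ i + ((M ∸ toℕ k) + toℕ k)              ≈⟨ +-congˡ (toℕ i) (∸+≈0 (<⇒≤ (toℕ<n k))) ⟩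
    toℕ i + 0                                   ≡⟨ +-identityʳ (toℕ i) ⟩
    toℕ i                                       ∎))
    where open Congruence M

  x+[M∸y]+z+y≈x+z : ∀ x {y} z → y ≤ M → x + (M ∸ y) + z + y ≈ x + z
  x+[M∸y]+z+y≈x+z x {y} z y≤M = begin
    x + (M ∸ y) + z + y     ≡⟨ cong (_+ y) (xy∙z≈xz∙y x (M ∸ y) z) ⟩
    x + z + (M ∸ y) + y     ≡⟨ +-assoc (x + z) (M ∸ y) y ⟩
    x + z + ((M ∸ y) + y)   ≈⟨ +-congˡ (x + z) (∸+≈0 y≤M) ⟩
    x + z + 0               ≡⟨ +-identityʳ (x + z) ⟩
    x + z                   ∎
    where open Congruence M

  conjugate-rotation-by-reflection : ∀ k i →
    ((k , true) ∙ (i , false)) ∙ (k , true) ⁻¹ ≡ (i , false) ⁻¹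
  conjugate-rotation-by-reflection k i = cong (_, false) (mod-cong (+-cancelʳ b (begin
    u + (M ∸ b) + n + b             ≈⟨ x+[M∸y]+z+y≈x+z u n (<⇒≤ (toℕ<n ⌊ toℕ k + n ⌋)) ⟩
    u + n                           ≈⟨ +-congʳ n (toℕ-mod (toℕ k + (M ∸ toℕ i))) ⟩
    toℕ k + (M ∸ toℕ i) + n         ≡⟨ xy∙z≈y∙xz (toℕ k) (M ∸ toℕ i) n ⟩
    (M ∸ toℕ i) + (toℕ k + n)       ≈⟨ +-congˡ (M ∸ toℕ i) (toℕ-mod (toℕ k + n)) ⟨
    (M ∸ toℕ i) + b                 ∎)))
    where
    open Congruence M
    u b : ℕ
    u = toℕ ⌊ toℕ k + (M ∸ toℕ i) ⌋
    b = toℕ ⌊ toℕ k + n ⌋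

  conjugate-reflection-by-rotation : ∀ k i →
    ((k , false) ∙ (i , true)) ∙ (k , false) ⁻¹ ≡ (⌊ toℕ i + 2 * toℕ k ⌋ , true)
  conjugate-reflection-by-rotation k i = cong (_, true) (mod-cong (begin
    toℕ ⌊ toℕ k + toℕ i ⌋ + (M ∸ toℕ ⌊ M ∸ toℕ k ⌋)
      ≈⟨ +-cong (toℕ-mod (toℕ k + toℕ i)) (M∸⌊M∸t⌋≈t (<⇒≤ (toℕ<n k))) ⟩
    (toℕ k + toℕ i) + toℕ k                         ≡⟨ rearrange (toℕ k) (toℕ i) ⟩
    toℕ i + 2 * toℕ k                               ∎))
    where
    open Congruence M
    rearrange : ∀ x y → (x + y) + x ≡ y + 2 * x
    rearrange = solve-∀

  conjugate-reflection-by-reflection : ∀ k i →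
    ((k , true) ∙ (i , true)) ∙ (k , true) ⁻¹ ≡ (⌊ (M ∸ toℕ i) + 2 * toℕ k ⌋ , true)
  conjugate-reflection-by-reflection k i = cong (_, true) (mod-cong (begin
    toℕ ⌊ toℕ k + (M ∸ toℕ i) + n ⌋ + toℕ ⌊ toℕ k + n ⌋
      ≈⟨ +-cong (toℕ-mod (toℕ k + (M ∸ toℕ i) + n)) (toℕ-mod (toℕ k + n)) ⟩
    (toℕ k + (M ∸ toℕ i) + n) + (toℕ k + n)  ≡⟨ rearrange (toℕ k) (M ∸ toℕ i) n ⟩
    ((M ∸ toℕ i) + 2 * toℕ k) + 2 * n        ≈⟨ +-congˡ ((M ∸ toℕ i) + 2 * toℕ k) d≈0 ⟩
    ((M ∸ toℕ i) + 2 * toℕ k) + 0            ≡⟨ +-identityʳ _ ⟩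
    (M ∸ toℕ i) + 2 * toℕ k                  ∎))
    where
    open Congruence M
    rearrange : ∀ x y z → (x + y + z) + (x + z) ≡ (y + 2 * x) + 2 * z
    rearrange = solve-∀

  M∸s+t≈₂0 : ∀ {s t} → s ≤ M → s ≈₂ t → (M ∸ s) + t ≈₂ 0
  M∸s+t≈₂0 {s} {t} s≤M s≈₂t = begin
    (M ∸ s) + t   ≈⟨ +-cong (M∸≈₂ s≤M) (≈-sym s≈₂t) ⟩
    s + s         ≡⟨ cong (s +_) (+-identityʳ s) ⟨
    2 * s         ≈⟨ 2*≈₂0 s ⟩
    0             ∎
    where open Congruence 2

  -- Conjugating by aᵏ adds 2k to the index, and k = (2n − i + j) / 2 is exact
  -- because i and j have the same parity.
  conjugate-of-same-parity : ∀ i j → parity (toℕ i) ≡ parity (toℕ j) → Conj Q (i , true) (j , true)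
  conjugate-of-same-parity i j same = (⌊ k ⌋ , false) , sym (trans
    (conjugate-reflection-by-rotation ⌊ k ⌋ i) (cong (_, true) (mod-toℕ j (begin
      toℕ i + 2 * toℕ ⌊ k ⌋          ≈⟨ +-congˡ (toℕ i) (*-congˡ 2 (toℕ-mod k)) ⟩
      toℕ i + 2 * k                  ≡⟨ cong (toℕ i +_) 2k≡s ⟩
      toℕ i + ((M ∸ toℕ i) + toℕ j)  ≡⟨ +-assoc (toℕ i) (M ∸ toℕ i) (toℕ j) ⟨
      (toℕ i + (M ∸ toℕ i)) + toℕ j  ≡⟨ cong (_+ toℕ j) (m+[n∸m]≡n (<⇒≤ (toℕ<n i))) ⟩
      M + toℕ j                      ≈⟨ +-congʳ (toℕ j) d≈0 ⟩
      toℕ j                          ∎))))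
    where
    open Congruence M
    s k : ℕ
    s = (M ∸ toℕ i) + toℕ j
    k = s / 2
    2k≡s : 2 * k ≡ s
    2k≡s = m*[n/m]≡n (m%n≡0⇒n∣m s 2
      (Congruence.%-≡ (M∸s+t≈₂0 (<⇒≤ (toℕ<n i)) (Congruence.mod-injective 2 same))))

  pow-a : ∀ k → pow Q a k ≡ (⌊ k ⌋ , false)
  pow-a zero    = refl
  pow-a (suc k) = trans (cong (a ∙_) (pow-a k))
    (cong (_, false) (mod-cong (+-cong (toℕ-mod 1) (toℕ-mod k))))
    where open Congruence M

  pow-a-toℕ : ∀ i → pow Q a (toℕ i) ≡ (i , false)
  pow-a-toℕ i = trans (pow-a (toℕ i))
    (cong (_, false) (Congruence.mod-toℕ M {toℕ i} i (Congruence.mk≈ refl)))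

  pow-rotation : ∀ i k → ∃ λ j → pow Q (i , false) k ≡ (j , false)
  pow-rotation i zero = zero , refl
  pow-rotation i (suc k) with pow-rotation i k
  ... | _ , eq = _ , cong ((i , false) ∙_) eq

  aⁱb∙e : ∀ i → (i , true) ∙ ε ≡ (i , true)
  aⁱb∙e i = cong (_, true) (mod-toℕ i (begin
    toℕ i + M   ≈⟨ +-congˡ (toℕ i) d≈0 ⟩
    toℕ i + 0   ≡⟨ +-identityʳ (toℕ i) ⟩
    toℕ i       ∎))
    where open Congruence M

  aⁱb∙aⁱb : ∀ i → (i , true) ∙ (i , true) ≡ (⌊ n ⌋ , false)
  aⁱb∙aⁱb i = cong (_, false) (mod-cong (begin
    toℕ i + (M ∸ toℕ i) + n   ≡⟨ cong (_+ n) (m+[n∸m]≡n (<⇒≤ (toℕ<n i))) ⟩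
    M + n                     ≈⟨ +-congʳ n d≈0 ⟩
    n                         ∎))
    where open Congruence M

  aⁱb∙aⁿ : ∀ i → (i , true) ∙ (⌊ n ⌋ , false) ≡ (⌊ toℕ i + n ⌋ , true)
  aⁱb∙aⁿ i = cong (λ t → ⌊ toℕ i + t ⌋ , true)
    (trans (cong (M ∸_) (toℕ⌊⌋-< n<M)) (trans (m+n∸m≡n n (n + 0)) (+-identityʳ n)))

  aⁱb∙aⁱ⁺ⁿb : ∀ i → (i , true) ∙ (⌊ toℕ i + n ⌋ , true) ≡ ε
  aⁱb∙aⁱ⁺ⁿb i = cong (_, false) (mod-toℕ zero (+-cancelʳ b (begin
    toℕ i + (M ∸ b) + n + b   ≈⟨ x+[M∸y]+z+y≈x+z (toℕ i) n (<⇒≤ (toℕ<n ⌊ toℕ i + n ⌋)) ⟩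
    toℕ i + n                 ≈⟨ toℕ-mod (toℕ i + n) ⟨
    b                         ∎)))
    where
    open Congruence M
    b : ℕ
    b = toℕ ⌊ toℕ i + n ⌋

  data ReflectionPower (i : Fin M) : Carrier → Set where
    e     : ReflectionPower i ε
    aⁱb   : ReflectionPower i (i , true)
    aⁿ    : ReflectionPower i (⌊ n ⌋ , false)
    aⁱ⁺ⁿb : ReflectionPower i (⌊ toℕ i + n ⌋ , true)

  reflection-pow : ∀ i k → ReflectionPower i (pow Q (i , true) k)
  reflection-pow i zero    = e
  reflection-pow i (suc k) = next (reflection-pow i k)
    where
    next : ∀ {x} → ReflectionPower i x → ReflectionPower i ((i , true) ∙ x)
    next e     = subst (ReflectionPower i) (sym (aⁱb∙e i)) aⁱb
    next aⁱb   = subst (ReflectionPower i) (sym (aⁱb∙aⁱb i)) aⁿ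
    next aⁿ    = subst (ReflectionPower i) (sym (aⁱb∙aⁿ i)) aⁱ⁺ⁿb
    next aⁱ⁺ⁿb = subst (ReflectionPower i) (sym (aⁱb∙aⁱ⁺ⁿb i)) e

  pow-aⁱb-2 : ∀ i → pow Q (i , true) 2 ≡ (⌊ n ⌋ , false)
  pow-aⁱb-2 i = trans (cong ((i , true) ∙_) (aⁱb∙e i)) (aⁱb∙aⁱb i)

  pow-aⁱb-3 : ∀ i → pow Q (i , true) 3 ≡ (⌊ toℕ i + n ⌋ , true)
  pow-aⁱb-3 i = trans (cong ((i , true) ∙_) (pow-aⁱb-2 i)) (aⁱb∙aⁿ i)

  -- Kinds of elements and the adjacency of CSEP(Q₄ₙ)

  -- The conjugacy classes, except that all classes {aⁱ, a⁻ⁱ} with i ≢ 0, n are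
  -- merged into `rotation`; `reflection p` is the class of the aⁱb with
  -- i ≡ p (mod 2). The names come from the dihedral quotient Q₄ₙ/⟨aⁿ⟩.
  data Kind : Set where
    identity central rotation : Kind
    reflection : Fin 2 → Kind

  rotationKind : ℕ → Kind
  rotationKind t with t ≟ 0 | t ≟ n
  ... | yes _ | _     = identity
  ... | no _  | yes _ = central
  ... | no _  | no _  = rotation

  kind : Carrier → Kind
  kind (i , false) = rotationKind (toℕ i)
  kind (i , true)  = reflection (parity (toℕ i))

  rotationKind-n : rotationKind n ≡ central
  rotationKind-n with n ≟ n
  ... | yes _   = refl
  ... | no n≢n  = ⊥-elim (n≢n refl)

  rotationKind-rotation : ∀ {t} → t ≢ 0 → t ≢ n → rotationKind t ≡ rotation
  rotationKind-rotation {t} t≢0 t≢n with t ≟ 0 | t ≟ n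
  ... | yes t≡0 | _     = ⊥-elim (t≢0 t≡0)
  ... | no _    | yes t≡n = ⊥-elim (t≢n t≡n)
  ... | no _    | no _  = refl

  rotationKind-cong : ∀ {s t} → (s ≡ 0 ⇔ t ≡ 0) → (s ≡ n ⇔ t ≡ n) → rotationKind s ≡ rotationKind t
  rotationKind-cong {s} {t} s0⇔t0 sn⇔tn with s ≟ 0 | t ≟ 0 | s ≟ n | t ≟ n
  ... | yes _   | yes _   | _       | _       = refl
  ... | yes s≡0 | no t≢0  | _       | _       = ⊥-elim (t≢0 (Equivalence.to s0⇔t0 s≡0))
  ... | no s≢0  | yes t≡0 | _       | _       = ⊥-elim (s≢0 (Equivalence.from s0⇔t0 t≡0))
  ... | no _    | no _    | yes _   | yes _   = refl
  ... | no _    | no _    | yes s≡n | no t≢n  = ⊥-elim (t≢n (Equivalence.to sn⇔tn s≡n))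
  ... | no _    | no _    | no s≢n  | yes t≡n = ⊥-elim (s≢n (Equivalence.from sn⇔tn t≡n))
  ... | no _    | no _    | no _    | no _    = refl

  negation-fixes-0-and-n : ∀ {s t} → s < M → s + t ≈ 0 → (t ≡ 0 → s ≡ 0) × (t ≡ n → s ≡ n)
  negation-fixes-0-and-n {s} {t} s<M s+t≈0 =
    (λ t≡0 → ≈⇒≡ s<M z<s (begin
      s        ≡⟨ +-identityʳ s ⟨
      s + 0    ≡⟨ cong (s +_) t≡0 ⟨
      s + t    ≈⟨ s+t≈0 ⟩
      0        ∎)) ,
    (λ t≡n → ≈⇒≡ s<M n<M (+-cancelʳ n (begin
      s + n    ≡⟨ cong (s +_) t≡n ⟨
      s + t    ≈⟨ s+t≈0 ⟩
      0        ≈⟨ d≈0 ⟨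
      M        ≡⟨ cong (n +_) (+-identityʳ n) ⟩
      n + n    ∎)))
    where open Congruence M

  rotationKind-neg : ∀ {s t} → s < M → t < M → s + t ≈ 0 → rotationKind s ≡ rotationKind t
  rotationKind-neg {s} {t} s<M t<M s+t≈0 = rotationKind-cong
    (mk⇔ (proj₁ t-fixes) (proj₁ s-fixes)) (mk⇔ (proj₂ t-fixes) (proj₂ s-fixes))
    where
    open Congruence M
    s-fixes : (t ≡ 0 → s ≡ 0) × (t ≡ n → s ≡ n)
    s-fixes = negation-fixes-0-and-n s<M s+t≈0
    t-fixes : (s ≡ 0 → t ≡ 0) × (s ≡ n → t ≡ n)
    t-fixes = negation-fixes-0-and-n t<M (begin
      t + s   ≡⟨ +-comm t s ⟩
      s + t   ≈⟨ s+t≈0 ⟩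
      0       ∎)

  kind-inverse-rotation : ∀ i → kind ((i , false) ⁻¹) ≡ kind (i , false)
  kind-inverse-rotation i = rotationKind-neg (toℕ<n ⌊ M ∸ toℕ i ⌋) (toℕ<n i) (begin
    toℕ ⌊ M ∸ toℕ i ⌋ + toℕ i   ≈⟨ +-congʳ (toℕ i) (toℕ-mod (M ∸ toℕ i)) ⟩
    (M ∸ toℕ i) + toℕ i         ≈⟨ ∸+≈0 (<⇒≤ (toℕ<n i)) ⟩
    0                           ∎)
    where open Congruence M

  kind-conjugate : ∀ g x → kind ((g ∙ x) ∙ g ⁻¹) ≡ kind x
  kind-conjugate (k , false) (i , false) = cong kind (conjugate-rotation-by-rotation k i)
  kind-conjugate (k , true)  (i , false) =
    trans (cong kind (conjugate-rotation-by-reflection k i)) (kind-inverse-rotation i)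
  kind-conjugate (k , false) (i , true)  = trans (cong kind (conjugate-reflection-by-rotation k i))
    (cong reflection (parity-cong (≈-trans (toℕ⌊⌋≈₂ _) (+2*≈₂ (toℕ i) (toℕ k)))))
    where open Congruence 2
  kind-conjugate (k , true)  (i , true)  = trans (cong kind (conjugate-reflection-by-reflection k i))
    (cong reflection (parity-cong (≈-trans (toℕ⌊⌋≈₂ _)
      (≈-trans (+2*≈₂ (M ∸ toℕ i) (toℕ k)) (M∸≈₂ (<⇒≤ (toℕ<n i)))))))
    where open Congruence 2

  -- The maximal cyclic subgroups ⟨a⟩ and ⟨aⁱb⟩ = {e, aⁱb, aⁿ, aⁱ⁺ⁿb};
  -- k ∈ c says that c contains elements of kind k.
  data MaxCyclic : Set where
    ⟨a⟩    : MaxCyclic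
    ⟨a^_b⟩ : Fin M → MaxCyclic

  generator : MaxCyclic → Carrier
  generator ⟨a⟩       = a
  generator ⟨a^ i b⟩  = i , true

  cyclicOf : Carrier → MaxCyclic
  cyclicOf (_ , false) = ⟨a⟩
  cyclicOf (i , true)  = ⟨a^ i b⟩

  infix 4 _∈_
  data _∈_ : Kind → MaxCyclic → Set where
    identity∈           : ∀ {c} → identity ∈ c
    central∈            : ∀ {c} → central ∈ c
    rotation∈           : rotation ∈ ⟨a⟩
    reflection∈         : ∀ {i p} → parity (toℕ i) ≡ p → reflection p ∈ ⟨a^ i b⟩
    reflection-shifted∈ : ∀ {i p} → parity (toℕ i + n) ≡ p → reflection p ∈ ⟨a^ i b⟩

  Linked : Kind → Kind → Set
  Linked k k′ = ∃ λ c → k ∈ c × k′ ∈ c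

  rotationKind∈⟨a⟩ : ∀ t → rotationKind t ∈ ⟨a⟩
  rotationKind∈⟨a⟩ t with t ≟ 0 | t ≟ n
  ... | yes _ | _     = identity∈
  ... | no _  | yes _ = central∈
  ... | no _  | no _  = rotation∈

  kind-aⁿ : kind (⌊ n ⌋ , false) ≡ central
  kind-aⁿ = trans (cong rotationKind (toℕ⌊⌋-< n<M)) rotationKind-n

  kind-pow∈ : ∀ z k → kind (pow Q z k) ∈ cyclicOf z
  kind-pow∈ (i , false) k with pow-rotation i k
  ... | j , eq = subst (λ x → kind x ∈ ⟨a⟩) (sym eq) (rotationKind∈⟨a⟩ (toℕ j))
  kind-pow∈ (i , true) k = kind-reflectionPower (reflection-pow i k)
    where
    kind-reflectionPower : ∀ {x} → ReflectionPower i x → kind x ∈ ⟨a^ i b⟩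
    kind-reflectionPower e     = identity∈
    kind-reflectionPower aⁱb   = reflection∈ refl
    kind-reflectionPower aⁿ    = subst (_∈ ⟨a^ i b⟩) (sym kind-aⁿ) central∈
    kind-reflectionPower aⁱ⁺ⁿb = reflection-shifted∈ (sym (parity-cong (toℕ⌊⌋≈₂ (toℕ i + n))))

  conj-refl : ∀ x → Conj Q x x
  conj-refl (i , false) = ε , sym (conjugate-rotation-by-rotation zero i)
  conj-refl (i , true)  = conjugate-of-same-parity i i refl

  conj-≡ : ∀ {x y} → x ≡ y → Conj Q x y
  conj-≡ {x} refl = conj-refl x

  aⁿ-by-index : ∀ {i} → toℕ i ≡ n → (i , false) ≡ (⌊ n ⌋ , false)
  aⁿ-by-index {i} i≡n = cong (_, false)
    (sym (Congruence.mod-toℕ M {n} i (Congruence.mk≈ (cong (_% M) (sym i≡n)))))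

  conjugate-pow : ∀ x c → kind x ∈ c → ∃ λ k → Conj Q x (pow Q (generator c) k)
  conjugate-pow (i , false) c mem with toℕ i ≟ 0 | toℕ i ≟ n
  conjugate-pow (i , false) c identity∈ | yes i≡0 | _ =
    0 , conj-≡ (cong (_, false) (toℕ-injective i≡0))
  conjugate-pow (i , false) ⟨a⟩ central∈ | no _ | yes i≡n =
    n , conj-≡ (trans (aⁿ-by-index i≡n) (sym (pow-a n)))
  conjugate-pow (i , false) ⟨a^ j b⟩ central∈ | no _ | yes i≡n =
    2 , conj-≡ (trans (aⁿ-by-index i≡n) (sym (pow-aⁱb-2 j)))
  conjugate-pow (i , false) ⟨a⟩ rotation∈ | no _ | no _ =
    toℕ i , conj-≡ (sym (pow-a-toℕ i))
  conjugate-pow (i , true) ⟨a^ j b⟩ (reflection∈ same) =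
    1 , subst (Conj Q (i , true)) (sym (aⁱb∙e j)) (conjugate-of-same-parity i j (sym same))
  conjugate-pow (i , true) ⟨a^ j b⟩ (reflection-shifted∈ same) =
    3 , subst (Conj Q (i , true)) (sym (pow-aⁱb-3 j)) (conjugate-of-same-parity i ⌊ toℕ j + n ⌋
      (trans (sym same) (sym (parity-cong (toℕ⌊⌋≈₂ (toℕ j + n))))))

  kind∈cyclicOf : ∀ {x x′ z} → Conj Q x x′ → InCyclic Q z x′ → kind x ∈ cyclicOf z
  kind∈cyclicOf {x} {z = z} (g , x′≡gxg⁻¹) (k , x′≡zᵏ) = subst (_∈ cyclicOf z)
    (trans (cong kind (trans (sym x′≡zᵏ) x′≡gxg⁻¹)) (kind-conjugate g x)) (kind-pow∈ z k)

  CSEP-adjacency : AdjacencyBy Linked (CSEP Q) kind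
  CSEP-adjacency x y = mk⇔
    (λ (x≢y , _ , _ , z , x~x′ , y~y′ , x′∈⟨z⟩ , y′∈⟨z⟩) →
      x≢y , cyclicOf z , kind∈cyclicOf x~x′ x′∈⟨z⟩ , kind∈cyclicOf y~y′ y′∈⟨z⟩)
    (λ (x≢y , c , x∈c , y∈c) →
      let (k , x~gᵏ) = conjugate-pow x c x∈c
          (l , y~gˡ) = conjugate-pow y c y∈c
      in x≢y , _ , _ , generator c , x~gᵏ , y~gˡ , (k , refl) , (l , refl))

  reflectionIndex : Fin 2 → Fin n → Fin M
  reflectionIndex p k = cast (*-comm n 2) (combine k p)

  parity-reflectionIndex : ∀ p k → parity (toℕ (reflectionIndex p k)) ≡ p
  parity-reflectionIndex p k = trans (parity-cong (begin
    toℕ (cast (*-comm n 2) (combine k p))   ≡⟨ toℕ-cast (*-comm n 2) (combine k p) ⟩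
    toℕ (combine k p)                      ≡⟨ toℕ-combine k p ⟩
    2 * toℕ k + toℕ p                      ≡⟨ +-comm (2 * toℕ k) (toℕ p) ⟩
    toℕ p + 2 * toℕ k                      ≈⟨ +2*≈₂ (toℕ p) (toℕ k) ⟩
    toℕ p                                  ∎)) (mod-toℕ {toℕ p} p (mk≈ refl))
    where open Congruence 2

  Linked-sym : Symmetric Linked
  Linked-sym (c , k∈c , k′∈c) = c , k′∈c , k∈c

  occurs : ∀ k → ∃ (k ∈_)
  occurs identity       = ⟨a⟩ , identity∈
  occurs central        = ⟨a⟩ , central∈
  occurs rotation       = ⟨a⟩ , rotation∈
  occurs (reflection p) =
    ⟨a^ reflectionIndex p zero b⟩ , reflection∈ (parity-reflectionIndex p zero)

  Linked-refl : ∀ k → Linked k k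
  Linked-refl k = let (c , k∈c) = occurs k in c , k∈c , k∈c

  hubKind : Fin 2 → Kind
  hubKind 0F = identity
  hubKind 1F = central

  hubKind-linked : ∀ h k → Linked (hubKind h) k
  hubKind-linked 0F k = let (c , k∈c) = occurs k in c , identity∈ , k∈c
  hubKind-linked 1F k = let (c , k∈c) = occurs k in c , central∈ , k∈c

  rotation-reflection-unlinked : ∀ {p} → ¬ Linked rotation (reflection p)
  rotation-reflection-unlinked (⟨a⟩ , _ , ())
  rotation-reflection-unlinked (⟨a^ _ b⟩ , () , _)

  reflections-linked : n % 2 ≡ 1 → ∀ p q → Linked (reflection p) (reflection q)
  reflections-linked _   0F 0F = Linked-refl _
  reflections-linked _   1F 1F = Linked-refl _
  reflections-linked odd 0F 1F =
    ⟨a^ zero b⟩ , reflection∈ refl ,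
    reflection-shifted∈ (Congruence.mod-toℕ 2 {n} 1F (Congruence.mk≈ odd))
  reflections-linked odd 1F 0F = Linked-sym (reflections-linked odd 0F 1F)

  parity-+-even : n % 2 ≡ 0 → ∀ t → parity (t + n) ≡ parity t
  parity-+-even even t =
    parity-cong {t + n} {t} (Congruence.mk≈ (%-remove-+ʳ t (m%n≡0⇒n∣m n 2 even)))

  reflections-unlinked : n % 2 ≡ 0 → ¬ Linked (reflection 0F) (reflection 1F)
  reflections-unlinked _    (⟨a⟩ , () , _)
  reflections-unlinked even (⟨a^ i b⟩ , 0∈ , 1∈) =
    contradiction (trans (sym (parity-of 0∈)) (parity-of 1∈)) λ ()
    where
    parity-of : ∀ {p} → reflection p ∈ ⟨a^ i b⟩ → parity (toℕ i) ≡ p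
    parity-of (reflection∈ eq)         = eq
    parity-of (reflection-shifted∈ eq) = trans (sym (parity-+-even even (toℕ i))) eq

  -- Vertex bijections and the isomorphisms

  OddVertex : Set
  OddVertex = V (GenComp (Hodd n) (Γodd n))

  -- a¹⁺ʲ and aⁿ⁺¹⁺ʲ are the two vertices in the block of the j-th rotation
  -- vertex of H, and aⁱb is vertex i / 2 in the block of reflection i mod 2.
  -- The aⁱb clause comes first so that the case tree splits on the Bool first,
  -- letting encode (i , true) compute for a variable i.
  encode : Carrier → OddVertex
  encode (i , true) = let q = remQuot 2 (cast (*-comm 2 n) i) in inj₂ (inj₂ (proj₂ q)) , proj₁ q
  encode (zero , false) = inj₁ 0F , 0F
  encode (suc i , false) with splitAt m i
  ... | inj₁ j       = inj₂ (inj₁ j) , 0F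
  ... | inj₂ zero    = inj₁ 1F , 0F
  ... | inj₂ (suc j) = inj₂ (inj₁ (cast (+-identityʳ m) j)) , 1F

  decode : OddVertex → Carrier
  decode (inj₁ 0F , _)        = zero , false
  decode (inj₁ 1F , _)        = suc (m ↑ʳ zero) , false
  decode (inj₂ (inj₁ j) , 0F) = suc (j ↑ˡ _) , false
  decode (inj₂ (inj₁ j) , 1F) = suc (m ↑ʳ suc (cast (sym (+-identityʳ m)) j)) , false
  decode (inj₂ (inj₂ p) , k)  = reflectionIndex p k , true

  decode-encode : ∀ x → decode (encode x) ≡ x
  decode-encode (zero , false) = refl
  decode-encode (suc i , false) with splitAt m i in eq
  ... | inj₁ j       = cong (λ i → suc i , false) (splitAt⁻¹-↑ˡ eq)
  ... | inj₂ zero    = cong (λ i → suc i , false) (splitAt⁻¹-↑ʳ eq)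
  ... | inj₂ (suc j) = cong (λ i → suc i , false)
    (trans (cong (λ j → m ↑ʳ suc j) (cast-involutive (sym (+-identityʳ m)) (+-identityʳ m) j))
      (splitAt⁻¹-↑ʳ eq))
  decode-encode (i , true) = cong (_, true)
    (trans (cong (cast (*-comm n 2)) (combine-remQuot {n} 2 (cast (*-comm 2 n) i)))
      (cast-involutive (*-comm n 2) (*-comm 2 n) i))

  encode-decode : ∀ v → encode (decode v) ≡ v
  encode-decode (inj₁ 0F , 0F) = refl
  encode-decode (inj₁ 1F , 0F) rewrite splitAt-↑ʳ m _ (zero {m + 0}) = refl
  encode-decode (inj₂ (inj₁ j) , 0F) rewrite splitAt-↑ˡ m j (suc (m + 0)) = refl
  encode-decode (inj₂ (inj₁ j) , 1F)
    rewrite splitAt-↑ʳ m _ (suc (cast (sym (+-identityʳ m)) j)) =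
    cong (λ j → inj₂ (inj₁ j) , 1F) (cast-involutive (+-identityʳ m) (sym (+-identityʳ m)) j)
  encode-decode (inj₂ (inj₂ p) , k) = cong (λ q → inj₂ (inj₂ (proj₂ q)) , proj₁ q)
    (trans (cong (remQuot 2) (cast-involutive (*-comm 2 n) (*-comm n 2) (combine k p)))
      (remQuot-combine k p))

  oddLabel : V (Hodd n) → Kind
  oddLabel = [ hubKind , [ (λ _ → rotation) , reflection ] ]

  evenLabel : V (Heven n) → Kind
  evenLabel = [ hubKind , [ (λ _ → rotation) , [ (λ _ → reflection 0F) , (λ _ → reflection 1F) ] ] ]

  kind-decode : ∀ v → kind (decode v) ≡ oddLabel (proj₁ v)
  kind-decode (inj₁ 0F , _)        = refl
  kind-decode (inj₁ 1F , _)        =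
    trans (cong (rotationKind ∘ suc) (trans (toℕ-↑ʳ m zero) (+-identityʳ m))) rotationKind-n
  kind-decode (inj₂ (inj₁ j) , 0F) = rotationKind-rotation (λ ())
    (λ eq → <⇒≢ (toℕ<n j) (trans (sym (toℕ-↑ˡ j _)) (suc-injective eq)))
  kind-decode (inj₂ (inj₁ j) , 1F) = rotationKind-rotation (λ ())
    (λ eq → m+1+n≢m m (trans (sym (toℕ-↑ʳ m _)) (suc-injective eq)))
  kind-decode (inj₂ (inj₂ p) , k)  = cong reflection (parity-reflectionIndex p k)

  vertices↔ : Carrier ↔ OddVertex
  vertices↔ = mk↔ₛ′ encode decode encode-decode decode-encode

  EvenVertex : Set
  EvenVertex = V (GenComp (Heven n) (Γeven n))

  oddToEven : OddVertex → EvenVertex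
  oddToEven (inj₁ h , u)         = inj₁ h , u
  oddToEven (inj₂ (inj₁ j) , s)  = inj₂ (inj₁ j) , s
  oddToEven (inj₂ (inj₂ 0F) , k) = inj₂ (inj₂ (inj₁ 0F)) , k
  oddToEven (inj₂ (inj₂ 1F) , k) = inj₂ (inj₂ (inj₂ 0F)) , k

  evenToOdd : EvenVertex → OddVertex
  evenToOdd (inj₁ h , u)                = inj₁ h , u
  evenToOdd (inj₂ (inj₁ j) , s)         = inj₂ (inj₁ j) , s
  evenToOdd (inj₂ (inj₂ (inj₁ 0F)) , k) = inj₂ (inj₂ 0F) , k
  evenToOdd (inj₂ (inj₂ (inj₂ 0F)) , k) = inj₂ (inj₂ 1F) , k

  oddLabel-evenToOdd : ∀ v → oddLabel (proj₁ (evenToOdd v)) ≡ evenLabel (proj₁ v)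
  oddLabel-evenToOdd (inj₁ _ , _)                = refl
  oddLabel-evenToOdd (inj₂ (inj₁ _) , _)         = refl
  oddLabel-evenToOdd (inj₂ (inj₂ (inj₁ 0F)) , _) = refl
  oddLabel-evenToOdd (inj₂ (inj₂ (inj₂ 0F)) , _) = refl

  odd↔even : OddVertex ↔ EvenVertex
  odd↔even = mk↔ₛ′ oddToEven evenToOdd to-from from-to
    where
    to-from : ∀ v → oddToEven (evenToOdd v) ≡ v
    to-from (inj₁ _ , _)                = refl
    to-from (inj₂ (inj₁ _) , _)         = refl
    to-from (inj₂ (inj₂ (inj₁ 0F)) , _) = refl
    to-from (inj₂ (inj₂ (inj₂ 0F)) , _) = refl
    from-to : ∀ v → evenToOdd (oddToEven v) ≡ v
    from-to (inj₁ _ , _)         = refl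
    from-to (inj₂ (inj₁ _) , _)  = refl
    from-to (inj₂ (inj₂ 0F) , _) = refl
    from-to (inj₂ (inj₂ 1F) , _) = refl

  Hodd-adjacency : n % 2 ≡ 1 → DistinctAdjacencyBy Linked (Hodd n) oddLabel
  Hodd-adjacency odd = ∨G-distinctAdjacency Linked Linked-sym
    (K-distinctAdjacency Linked (λ u v → hubKind-linked u (hubKind v)))
    (∪G-distinctAdjacency Linked Linked-sym
      (K-distinctAdjacency Linked (λ _ _ → Linked-refl rotation))
      (K-distinctAdjacency Linked (reflections-linked odd))
      (λ _ _ → rotation-reflection-unlinked))
    (λ u _ → hubKind-linked u _)

  Heven-adjacency : n % 2 ≡ 0 → DistinctAdjacencyBy Linked (Heven n) evenLabel
  Heven-adjacency even = ∨G-distinctAdjacency Linked Linked-sym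
    (K-distinctAdjacency Linked (λ u v → hubKind-linked u (hubKind v)))
    (∪G-distinctAdjacency Linked Linked-sym
      (K-distinctAdjacency Linked (λ _ _ → Linked-refl rotation))
      (∪G-distinctAdjacency Linked Linked-sym
        (K-distinctAdjacency Linked (λ _ _ → Linked-refl (reflection 0F)))
        (K-distinctAdjacency Linked (λ _ _ → Linked-refl (reflection 1F)))
        (λ _ _ → reflections-unlinked even))
      (λ { _ (inj₁ _) → rotation-reflection-unlinked ; _ (inj₂ _) → rotation-reflection-unlinked }))
    (λ u _ → hubKind-linked u _)

  Γodd-complete : ∀ i u v → Adj (Γodd n i) u v ⇔ u ≢ v
  Γodd-complete (inj₁ _)        _ _ = ⇔.refl
  Γodd-complete (inj₂ (inj₁ _)) _ _ = ⇔.refl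
  Γodd-complete (inj₂ (inj₂ _)) _ _ = ⇔.refl

  Γeven-complete : ∀ i u v → Adj (Γeven n i) u v ⇔ u ≢ v
  Γeven-complete (inj₁ _)        _ _ = ⇔.refl
  Γeven-complete (inj₂ (inj₁ _)) _ _ = ⇔.refl
  Γeven-complete (inj₂ (inj₂ _)) _ _ = ⇔.refl

  CSEP≅odd : n % 2 ≡ 1 → CSEP Q ≅ GenComp (Hodd n) (Γodd n)
  CSEP≅odd odd = ≅-byLabels Linked CSEP-adjacency
    (GenComp-adjacency Linked (≡-dec Fin._≟_ (≡-dec Fin._≟_ Fin._≟_)) Γodd-complete
      (Linked-refl ∘ oddLabel) (Hodd-adjacency odd))
    vertices↔ kind-decode

  CSEP≅even : n % 2 ≡ 0 → CSEP Q ≅ GenComp (Heven n) (Γeven n)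
  CSEP≅even even = ≅-byLabels Linked CSEP-adjacency
    (GenComp-adjacency Linked (≡-dec Fin._≟_ (≡-dec Fin._≟_ (≡-dec Fin._≟_ Fin._≟_))) Γeven-complete
      (Linked-refl ∘ evenLabel) (Heven-adjacency even))
    (↔-trans vertices↔ odd↔even)
    (λ v → trans (kind-decode (evenToOdd v)) (oddLabel-evenToOdd v))

mainTheorem7 : (n : ℕ) .{{_ : NonZero n}} → 2 ≤ n →
    ((n % 2 ≡ 1) → CSEP (Quaternion n) ≅ GenComp (Hodd n) (Γodd n))
    × ((n % 2 ≡ 0) → CSEP (Quaternion n) ≅ GenComp (Heven n) (Γeven n))
mainTheorem7 (suc m) _ = CSEP≅odd m , CSEP≅even m
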